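{- Let $G$ be a connected graph of order $n\ge 3$ and diameter $d$ with $\eta_p(G)=k$. Then $n\le k\,(d^{k-1}-(d-1)^{k-1})$.
   Context: Graphs are finite, simple, undirected and connected. For $v\in V(G)$ and $S\subseteq V(G)$, $d(v,S)=\min\{d(v,w):w\in S\}$. For a partition $\Pi=\{S_1,\dots,S_k\}$ of $V(G)$, $r(u|\Pi)=(d(u,S_1),\dots,d(u,S_k))$; $\Pi$ is resolving if $r(u|\Pi)\ne r(v|\Pi)$ for all distinct $u,v$, and dominating if each vertex $v$ has $d(v,S_j)=1$ for some $j$. $\eta_p(G)$ is the minimum cardinality of a partition that is both resolving and dominating. -}

module Defs where

open import Data.Nat using (ℕ; zero; suc; _≤_; _<_; _⊓_)
open import Data.Fin using (Fin; _≟_)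
open import Data.Fin.Properties using ()
open import Data.Bool using (Bool; true; false; T; _∨_; _∧_; if_then_else_)
open import Data.List using (List; foldr)
open import Data.List using () renaming (allFin to allFinL)
open import Data.Product using (Σ; ∃; ∃-syntax; _×_; _,_)
open import Relation.Nullary using (¬_; does)
open import Relation.Binary.PropositionalEquality using (_≡_)

record Graph (n : ℕ) : Set where
  field
    adj   : Fin n → Fin n → Bool
    sym   : ∀ u v → adj u v ≡ adj v u
    irrefl : ∀ v → adj v v ≡ false
open Graph public

data Walk {n : ℕ} (G : Graph n) : Fin n → Fin n → ℕ → Set where
  here : ∀ {v} → Walk G v v zero
  step : ∀ {u w v m} → T (adj G u w) → Walk G w v m → Walk G u v (suc m)

Connected : ∀ {n} → Graph n → Set
Connected G = ∀ u v → ∃[ m ] Walk G u v m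

anyFin : ∀ {n} → (Fin n → Bool) → Bool
anyFin {n} p = foldr (λ w acc → p w ∨ acc) false (allFinL n)

walk? : ∀ {n} → Graph n → ℕ → Fin n → Fin n → Bool
walk? G zero    u v = does (u ≟ v)
walk? G (suc m) u v = anyFin (λ w → adj G u w ∧ walk? G m w v)

-- Distance: least m (searching m = 0,1,...,n-1) with a walk of length m;
-- in a connected graph on n vertices this search always succeeds.
-- (Unreachable pairs would get value n; irrelevant for connected graphs.)
searchFrom : ∀ {n} → Graph n → Fin n → Fin n → ℕ → ℕ → ℕ
searchFrom {n} G u v m zero = n
searchFrom G u v m (suc fuel) =
  if walk? G m u v then m else searchFrom G u v (suc m) fuel

dist : ∀ {n} → Graph n → Fin n → Fin n → ℕ
dist {n} G u v = searchFrom G u v zero n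

-- A partition of V(G) into k classes S_0,...,S_{k-1}: a map assigning each
-- vertex its class, every class nonempty.
Partition : ℕ → ℕ → Set
Partition n k = Σ (Fin n → Fin k) λ c → ∀ (j : Fin k) → ∃[ w ] c w ≡ j

-- d(v, S_j) = min { d(v,w) : w ∈ S_j }  (default n for an empty class,
-- which never occurs for a partition).
distToClass : ∀ {n k} → Graph n → (Fin n → Fin k) → Fin n → Fin k → ℕ
distToClass {n} G c v j =
  foldr (λ w acc → if does (c w ≟ j) then dist G v w ⊓ acc else acc) n (allFinL n)

Resolving : ∀ {n k} → Graph n → Partition n k → Set
Resolving G (c , _) =
  ∀ u v → ¬ (u ≡ v) → ∃[ j ] ¬ (distToClass G c u j ≡ distToClass G c v j)

Dominating : ∀ {n k} → Graph n → Partition n k → Set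
Dominating G (c , _) = ∀ v → ∃[ j ] distToClass G c v j ≡ 1

ResolvingDominating : ∀ {n k} → Graph n → Partition n k → Set
ResolvingDominating G P = Resolving G P × Dominating G P

EtaP : ∀ {n} → Graph n → ℕ → Set
EtaP {n} G k =
  (Σ (Partition n k) (ResolvingDominating G)) ×
  (∀ k' (P : Partition n k') → ResolvingDominating G P → k ≤ k')

Diameter : ∀ {n} → Graph n → ℕ → Set
Diameter G d = (∀ u v → dist G u v ≤ d) × (∃[ u ] ∃[ v ] dist G u v ≡ d)

module Submission where

-- Let c : V → {S_1,…,S_k} be a resolving dominating partition of a graph G of
-- diameter d, and write r(v)_j = d(v,S_j).  The vertex v is recorded by its
-- own class c(v) together with its SIGNATURE, the vector of the k-1 distances
-- from v to the other classes.
--   * Since r(v)_{c(v)} = 0, class and signature determine r(v); as the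
--     partition is resolving, the map v ↦ (c(v), signature v) is injective.
--   * Every entry of a signature lies in {1,…,d} (v is outside the other,
--     nonempty, classes) and, as the partition is dominating, some entry is 1.
--   * There are exactly d^(k-1) - (d-1)^(k-1) such vectors.  The degenerate cases k = 0 and d = 0 are
-- impossible, since a graph with a vertex has a class and a dominating
-- partition needs a distance 1 ≤ d.

open import Defs hiding (sym)
open import Data.Nat using (ℕ; zero; suc; _≤_; _*_; _+_; _∸_; _^_; _⊓_; z≤n; s≤s)
open import Data.Nat.Properties
  using (≤-trans; ≤-reflexive; m⊓n≤m; m⊓n≤n; ⊓-glb; n≤0⇒n≡0; 1+n≰n;
         +-assoc; *-distribˡ-+; m+n∸n≡m; module ≤-Reasoning)
open import Data.Fin as Fin using (Fin; punchIn; punchOut; combine)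
open import Data.Fin.Properties using (combine-injective; injective⇒≤; punchIn-punchOut; punchInᵢ≢i)
open import Data.Bool using (Bool; true; false; if_then_else_)
open import Data.List as List using (List; []; _∷_; _++_; map; upTo; length; foldr; cartesianProductWith)
open import Data.List.Properties using (length-++; length-map; length-upTo)
open import Data.List.Membership.Propositional using (_∈_)
open import Data.List.Membership.Propositional.Properties
  using (∈-upTo⁺; ∈-++⁺ˡ; ∈-++⁺ʳ; ∈-map⁺; ∈-allFin; ∈-cartesianProductWith⁺)
open import Data.List.Relation.Unary.Any as ListAny using (here; there)
open import Data.List.Relation.Unary.Any.Properties using (lookup-index)
open import Data.Vec as Vec using (Vec; []; _∷_; tabulate)
open import Data.Vec.Properties using (lookup∘tabulate)
open import Data.Vec.Membership.Propositional using () renaming (_∈_ to _∈ᵥ_)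
open import Data.Vec.Relation.Unary.All using (All; []; _∷_)
import Data.Vec.Relation.Unary.All.Properties as AllProperties
import Data.Vec.Relation.Unary.Any as VecAny
import Data.Vec.Relation.Unary.Any.Properties as AnyProperties
open import Data.Product using (_,_; proj₁; proj₂)
open import Data.Empty using (⊥-elim)
open import Relation.Nullary using (does; yes; no)
open import Relation.Binary.PropositionalEquality
  using (_≡_; _≢_; refl; sym; trans; cong; cong₂; subst; module ≡-Reasoning)

length-cartesianProductWith : ∀ {A B C : Set} (f : A → B → C) (xs : List A) (ys : List B) →
  length (cartesianProductWith f xs ys) ≡ length xs * length ys
length-cartesianProductWith f [] ys = refl
length-cartesianProductWith f (x ∷ xs) ys = begin
  length (map (f x) ys ++ cartesianProductWith f xs ys)
    ≡⟨ length-++ (map (f x) ys) ⟩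
  length (map (f x) ys) + length (cartesianProductWith f xs ys)
    ≡⟨ cong₂ _+_ (length-map (f x) ys) (length-cartesianProductWith f xs ys) ⟩
  length ys + length xs * length ys ∎
  where open ≡-Reasoning

module Enumeration {A : Set} where

  vectors : List A → (m : ℕ) → List (Vec A m)
  vectors xs zero    = [] ∷ []
  vectors xs (suc m) = cartesianProductWith _∷_ xs (vectors xs m)

  length-vectors : ∀ xs m → length (vectors xs m) ≡ length xs ^ m
  length-vectors xs zero    = refl
  length-vectors xs (suc m) =
    trans (length-cartesianProductWith _∷_ xs (vectors xs m))
          (cong (length xs *_) (length-vectors xs m))

  ∈-vectors : ∀ {xs m} {v : Vec A m} → All (_∈ xs) v → v ∈ vectors xs m
  ∈-vectors []             = here refl
  ∈-vectors (x∈xs ∷ v∈xs) = ∈-cartesianProductWith⁺ _∷_ x∈xs (∈-vectors v∈xs)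

  -- The vectors over the alphabet a ∷ rest in which the letter a occurs:
  -- either a comes first, or the head is from rest and a occurs in the tail.
  hitting : A → List A → (m : ℕ) → List (Vec A m)
  hitting a rest zero    = []
  hitting a rest (suc m) =
    map (a ∷_) (vectors (a ∷ rest) m) ++ cartesianProductWith _∷_ rest (hitting a rest m)

  -- Complementary counting: the vectors avoiding a are the vectors over rest.
  length-hitting : ∀ a rest m →
    length (hitting a rest m) + length rest ^ m ≡ suc (length rest) ^ m
  length-hitting a rest zero    = refl
  length-hitting a rest (suc m) = begin
    length (map (a ∷_) (vectors (a ∷ rest) m) ++ cartesianProductWith _∷_ rest (hitting a rest m))
      + r * r ^ m
      ≡⟨ cong (_+ r * r ^ m) (length-++ (map (a ∷_) (vectors (a ∷ rest) m))) ⟩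
    length (map (a ∷_) (vectors (a ∷ rest) m))
      + length (cartesianProductWith _∷_ rest (hitting a rest m)) + r * r ^ m
      ≡⟨ cong₂ (λ x y → x + y + r * r ^ m)
           (trans (length-map (a ∷_) (vectors (a ∷ rest) m)) (length-vectors (a ∷ rest) m))
           (length-cartesianProductWith _∷_ rest (hitting a rest m)) ⟩
    suc r ^ m + r * h + r * r ^ m
      ≡⟨ +-assoc (suc r ^ m) (r * h) (r * r ^ m) ⟩
    suc r ^ m + (r * h + r * r ^ m)
      ≡⟨ cong (suc r ^ m +_) (sym (*-distribˡ-+ r h (r ^ m))) ⟩
    suc r ^ m + r * (h + r ^ m)
      ≡⟨ cong (λ x → suc r ^ m + r * x) (length-hitting a rest m) ⟩
    suc r ^ m + r * suc r ^ m ∎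
    where
    open ≡-Reasoning
    r = length rest
    h = length (hitting a rest m)

  ∈-hitting : ∀ {a rest m} {v : Vec A m} → All (_∈ a ∷ rest) v → a ∈ᵥ v → v ∈ hitting a rest m
  ∈-hitting {a} (_ ∷ v∈) (VecAny.here refl) = ∈-++⁺ˡ (∈-map⁺ (a ∷_) (∈-vectors v∈))
  ∈-hitting {a} (here refl ∷ v∈) (VecAny.there _) = ∈-++⁺ˡ (∈-map⁺ (a ∷_) (∈-vectors v∈))
  ∈-hitting {a} {rest} {suc m} (there x∈rest ∷ v∈) (VecAny.there a∈v) =
    ∈-++⁺ʳ (map (a ∷_) (vectors (a ∷ rest) m)) (∈-cartesianProductWith⁺ _∷_ x∈rest (∈-hitting v∈ a∈v))

open Enumeration

-- The letters 2,…,d'+1; together with 1 they form the alphabet {1,…,d'+1}.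
twoTo : ℕ → List ℕ
twoTo d' = map (2 +_) (upTo d')

∈-oneTo : ∀ {d' x} → 1 ≤ x → x ≤ suc d' → x ∈ 1 ∷ twoTo d'
∈-oneTo {x = suc zero}    _ _               = here refl
∈-oneTo {x = suc (suc x)} _ (s≤s (s≤s x≤d)) = there (∈-map⁺ (2 +_) (∈-upTo⁺ (s≤s x≤d)))

length-hittingOne : ∀ d' m → length (hitting 1 (twoTo d') m) ≡ suc d' ^ m ∸ d' ^ m
length-hittingOne d' m = begin
  length (hitting 1 (twoTo d') m)                   ≡⟨ m+n∸n≡m _ (d' ^ m) ⟨
  length (hitting 1 (twoTo d') m) + d' ^ m ∸ d' ^ m
    ≡⟨ cong (λ r → length (hitting 1 (twoTo d') m) + r ^ m ∸ r ^ m) (sym length-twoTo) ⟩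
  length (hitting 1 (twoTo d') m) + r ^ m ∸ r ^ m    ≡⟨ cong (_∸ r ^ m) (length-hitting 1 (twoTo d') m) ⟩
  suc r ^ m ∸ r ^ m                                  ≡⟨ cong (λ r → suc r ^ m ∸ r ^ m) length-twoTo ⟩
  suc d' ^ m ∸ d' ^ m ∎
  where
  open ≡-Reasoning
  r = length (twoTo d')
  length-twoTo : length (twoTo d') ≡ d'
  length-twoTo = trans (length-map (2 +_) (upTo d')) (length-upTo d')

labelled-injection-bound : ∀ {B : Set} {n k} (L : List B) (label : Fin n → Fin k) (key : Fin n → B) →
  (∀ x → key x ∈ L) → (∀ x y → label x ≡ label y → key x ≡ key y → x ≡ y) →
  n ≤ k * length L
labelled-injection-bound L label key key∈L determined = injective⇒≤ {f = code} code-injective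
  where
  code : _ → Fin _
  code x = combine (label x) (ListAny.index (key∈L x))

  same-key : ∀ x y → ListAny.index (key∈L x) ≡ ListAny.index (key∈L y) → key x ≡ key y
  same-key x y i≡j = trans (lookup-index (key∈L x))
                           (trans (cong (List.lookup L) i≡j) (sym (lookup-index (key∈L y))))

  code-injective : ∀ {x y} → code x ≡ code y → x ≡ y
  code-injective {x} {y} eq with combine-injective (label x) _ (label y) _ eq
  ... | same-label , same-index = determined x y same-label (same-key x y same-index)

if-true : ∀ {b : Bool} {x y : ℕ} → b ≡ true → (if b then x else y) ≡ x
if-true refl = refl

if-false : ∀ {b : Bool} {x y : ℕ} → b ≡ false → (if b then x else y) ≡ y
if-false refl = refl

dist-self : ∀ {n} (G : Graph n) v → dist G v v ≡ 0
dist-self {suc n} G v = if-true v≟v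
  where
  v≟v : does (v Fin.≟ v) ≡ true
  v≟v with v Fin.≟ v
  ... | yes _  = refl
  ... | no v≢v = ⊥-elim (v≢v refl)

searchFrom-positive : ∀ {n} (G : Graph (suc n)) u w m fuel → 1 ≤ m → 1 ≤ searchFrom G u w m fuel
searchFrom-positive G u w m zero       _   = s≤s z≤n
searchFrom-positive G u w m (suc fuel) 1≤m with walk? G m u w
... | true  = 1≤m
... | false = searchFrom-positive G u w (suc m) fuel (s≤s z≤n)

dist-positive : ∀ {n} (G : Graph n) v w → v ≢ w → 1 ≤ dist G v w
dist-positive {suc n} G v w v≢w =
  subst (1 ≤_) (sym (if-false v≟w)) (searchFrom-positive G v w 1 n (s≤s z≤n))
  where
  v≟w : does (v Fin.≟ w) ≡ false
  v≟w with v Fin.≟ w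
  ... | yes v≡w = ⊥-elim (v≢w v≡w)
  ... | no _    = refl

module ClassDistance {n k} (G : Graph n) (c : Fin n → Fin k) (v : Fin n) (j : Fin k) where

  private
    minimum : List (Fin n) → ℕ
    minimum = foldr (λ w acc → if does (c w Fin.≟ j) then dist G v w ⊓ acc else acc) n

    minimum-≤ : ∀ ws w → w ∈ ws → c w ≡ j → minimum ws ≤ dist G v w
    minimum-≤ (x ∷ ws) w w∈ cw≡j with c x Fin.≟ j | w∈
    ... | yes _    | here refl  = m⊓n≤m _ _
    ... | yes _    | there w∈ws = ≤-trans (m⊓n≤n _ _) (minimum-≤ ws w w∈ws cw≡j)
    ... | no cx≢j  | here refl  = ⊥-elim (cx≢j cw≡j)
    ... | no _     | there w∈ws = minimum-≤ ws w w∈ws cw≡j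

    minimum-≥ : ∀ {L} ws → L ≤ n → (∀ w → c w ≡ j → L ≤ dist G v w) → L ≤ minimum ws
    minimum-≥ []       L≤n _     = L≤n
    minimum-≥ (x ∷ ws) L≤n bound with c x Fin.≟ j
    ... | yes cx≡j = ⊓-glb (bound x cx≡j) (minimum-≥ ws L≤n bound)
    ... | no _     = minimum-≥ ws L≤n bound

  distToClass-≤ : ∀ w → c w ≡ j → distToClass G c v j ≤ dist G v w
  distToClass-≤ w cw≡j = minimum-≤ (List.allFin n) w (∈-allFin w) cw≡j

  distToClass-≥ : ∀ {L} → L ≤ n → (∀ w → c w ≡ j → L ≤ dist G v w) → L ≤ distToClass G c v j
  distToClass-≥ L≤n bound = minimum-≥ (List.allFin n) L≤n bound

open ClassDistance

module PartitionDistances {n k} (G : Graph n) (P : Partition n k) where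

  class : Fin n → Fin k
  class = proj₁ P

  r : Fin n → Fin k → ℕ
  r = distToClass G class

  r-own : ∀ v → r v (class v) ≡ 0
  r-own v = n≤0⇒n≡0 (≤-trans (distToClass-≤ G class v (class v) v refl) (≤-reflexive (dist-self G v)))

  r-other : ∀ v j → class v ≢ j → 1 ≤ r v j
  r-other v j cv≢j = distToClass-≥ G class v j (one≤n v)
    (λ w cw≡j → dist-positive G v w (λ v≡w → cv≢j (trans (cong class v≡w) cw≡j)))
    where
    one≤n : Fin n → 1 ≤ n
    one≤n Fin.zero    = s≤s z≤n
    one≤n (Fin.suc _) = s≤s z≤n

  r-≤-diameter : ∀ {d} → (∀ u w → dist G u w ≤ d) → ∀ v j → r v j ≤ d
  r-≤-diameter dist≤d v j with proj₂ P j
  ... | w , cw≡j = ≤-trans (distToClass-≤ G class v j w cw≡j) (dist≤d v w)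

  dominating-other : ∀ v j → r v j ≡ 1 → class v ≢ j
  dominating-other v j rvj≡1 cv≡j = 1+n≰n (≤-reflexive (trans (sym rvj≡1) (trans (cong (r v) (sym cv≡j)) (r-own v))))

-- The signature of v: distances to the classes other than its own, listed
-- through the order-preserving bijection punchIn (class v) : Fin k' → Fin (suc k') ∖ {class v}.
module Signature {n k'} (G : Graph n) (P : Partition n (suc k')) where
  open PartitionDistances G P

  signature : Fin n → Vec ℕ k'
  signature v = tabulate (λ i → r v (punchIn (class v) i))

  signature-entry : ∀ v i → Vec.lookup (signature v) i ≡ r v (punchIn (class v) i)
  signature-entry v i = lookup∘tabulate (λ i → r v (punchIn (class v) i)) i

  signature-determines : ∀ u v → class u ≡ class v → signature u ≡ signature v → ∀ j → r u j ≡ r v j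
  signature-determines u v cu≡cv su≡sv j with class u Fin.≟ j
  ... | yes cu≡j = begin
    r u j         ≡⟨ cong (r u) (sym cu≡j) ⟩
    r u (class u) ≡⟨ r-own u ⟩
    0             ≡⟨ r-own v ⟨
    r v (class v) ≡⟨ cong (r v) (trans (sym cu≡cv) cu≡j) ⟩
    r v j ∎
    where open ≡-Reasoning
  ... | no cu≢j = begin
    r u j                      ≡⟨ cong (r u) (punchIn-punchOut cu≢j) ⟨
    r u (punchIn (class u) i)  ≡⟨ signature-entry u i ⟨
    Vec.lookup (signature u) i ≡⟨ cong (λ s → Vec.lookup s i) su≡sv ⟩
    Vec.lookup (signature v) i ≡⟨ signature-entry v i ⟩
    r v (punchIn (class v) i)  ≡⟨ cong (λ c → r v (punchIn c i)) (sym cu≡cv) ⟩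
    r v (punchIn (class u) i)  ≡⟨ cong (r v) (punchIn-punchOut cu≢j) ⟩
    r v j ∎
    where
    open ≡-Reasoning
    i = punchOut cu≢j

  signature-injective : Resolving G P → ∀ u v → class u ≡ class v → signature u ≡ signature v → u ≡ v
  signature-injective resolving u v cu≡cv su≡sv with u Fin.≟ v
  ... | yes u≡v = u≡v
  ... | no u≢v with resolving u v u≢v
  ...   | j , ruj≢rvj = ⊥-elim (ruj≢rvj (signature-determines u v cu≡cv su≡sv j))

  signature-entries : ∀ {d'} → (∀ u w → dist G u w ≤ suc d') → ∀ v → All (_∈ 1 ∷ twoTo d') (signature v)
  signature-entries dist≤d v = AllProperties.tabulate⁺ λ i →
    ∈-oneTo (r-other v _ (λ cv≡ → punchInᵢ≢i (class v) i (sym cv≡))) (r-≤-diameter dist≤d v _)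

  signature-hits-one : Dominating G P → ∀ v → 1 ∈ᵥ signature v
  signature-hits-one dominating v with dominating v
  ... | j , rvj≡1 = AnyProperties.tabulate⁺ i (sym (trans (cong (r v) (punchIn-punchOut cv≢j)) rvj≡1))
    where
    cv≢j = dominating-other v j rvj≡1
    i = punchOut cv≢j

mainTheorem12 : ∀ (n : ℕ) (G : Graph n) (d k : ℕ) →
    Connected G → 3 ≤ n → Diameter G d → EtaP G k →
    n ≤ k * (d ^ (k ∸ 1) ∸ (d ∸ 1) ^ (k ∸ 1))
mainTheorem12 (suc n) G d zero _ _ _ (((class , _) , _) , _) with class Fin.zero
... | ()
mainTheorem12 (suc n) G zero (suc k') _ _ (dist≤0 , _) ((P , _ , dominating) , _)
  with dominating Fin.zero
... | j , r≡1 = ⊥-elim (1+n≰n (≤-trans (≤-reflexive (sym r≡1)) (r-≤-diameter dist≤0 Fin.zero j)))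
  where open PartitionDistances G P
mainTheorem12 (suc n) G (suc d') (suc k') _ _ (dist≤d , _) ((P , resolving , dominating) , _) =
  begin
    suc n                                        ≤⟨ labelled-injection-bound (hitting 1 (twoTo d') k')
                                                      class signature signatures-hit
                                                      (signature-injective resolving) ⟩
    suc k' * length (hitting 1 (twoTo d') k')    ≡⟨ cong (suc k' *_) (length-hittingOne d' k') ⟩
    suc k' * (suc d' ^ k' ∸ d' ^ k')             ∎
  where
  open ≤-Reasoning
  open PartitionDistances G P
  open Signature G P
  signatures-hit : ∀ v → signature v ∈ hitting 1 (twoTo d') k'
  signatures-hit v = ∈-hitting (signature-entries dist≤d v) (signature-hits-one dominating v)
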